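{- Let $D$ be any digraph of order $n$. Then $\gamma_{so}(D)=n$ if and only if for every vertex $u$ of $D$, $d^+(u)=0$ or $d^-(u)=0$.
   Context: Digraphs $D=(V,A)$ are finite, without loops or multiple arcs (pairs of opposite arcs allowed). $N^+(v)=\{w: vw\in A\}$, $N^-(v)=\{w: wv\in A\}$, $d^\pm(v)=|N^\pm(v)|$. $S\subseteq V$ is out-dominating if every $v\in V\setminus S$ has an in-neighbor in $S$. $S$ is a secure out-dominating set (SODS) if $S$ is out-dominating and for every $v\in V\setminus S$ there is $u\in(N^+(v)\cup N^-(v))\cap S$ such that $(S\setminus\{u\})\cup\{v\}$ is out-dominating; $\gamma_{so}(D)$ is the minimum size of an SODS. -}

module Defs where

open import Data.Nat using (ℕ; _≤_)
open import Data.Bool using (Bool; true; false; T)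
open import Data.Fin using (Fin)
open import Data.Fin.Subset using (Subset; _∈_; _∉_; ∣_∣; _∪_; ⁅_⁆; _-_)
open import Data.Vec using (tabulate)
open import Data.Product using (Σ; ∃; _×_; _,_)
open import Data.Sum using (_⊎_)
open import Relation.Nullary using (¬_)
open import Relation.Binary.PropositionalEquality using (_≡_)

-- A digraph of order n: vertex set Fin n, arc relation given as a Boolean
-- matrix (arc u v ≡ true means uv ∈ A), no loops.  Pairs of opposite arcs
-- are allowed; multiple arcs cannot occur in this representation.
record Digraph (n : ℕ) : Set where
  field
    arc      : Fin n → Fin n → Bool
    loopless : ∀ v → arc v v ≡ false

open Digraph public

module _ {n : ℕ} (D : Digraph n) where

  Arc : Fin n → Fin n → Set
  Arc u v = T (arc D u v)

  N⁺ : Fin n → Subset n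
  N⁺ v = tabulate (λ w → arc D v w)

  N⁻ : Fin n → Subset n
  N⁻ v = tabulate (λ w → arc D w v)

  d⁺ : Fin n → ℕ
  d⁺ v = ∣ N⁺ v ∣

  d⁻ : Fin n → ℕ
  d⁻ v = ∣ N⁻ v ∣

  OutDominating : Subset n → Set
  OutDominating S = ∀ v → v ∉ S → ∃ λ u → u ∈ S × Arc u v

  SODS : Subset n → Set
  SODS S = OutDominating S ×
    (∀ v → v ∉ S → ∃ λ u → u ∈ S × (Arc v u ⊎ Arc u v)
                          × OutDominating ((S - u) ∪ ⁅ v ⁆))

  γso≡ : ℕ → Set
  γso≡ k = (∃ λ S → SODS S × ∣ S ∣ ≡ k) × (∀ S → SODS S → k ≤ ∣ S ∣)

-- A vertex u with an in-neighbour a and an out-neighbour b is the only obstruction.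
-- If such a u exists, V ∖ {u} is already a secure out-dominating set: u is dominated
-- by a, and swapping u for b keeps domination because the arc u b dominates b.
-- If every vertex is a source or a sink, a vertex v outside an SODS S is dominated,
-- hence a sink, so its defender w ∈ S sends an arc to v; after the swap w itself
-- must be dominated, making w a vertex with both an in- and an out-arc.
module Submission where

open import Defs
open import Data.Nat using (ℕ; suc; _<_; _≤_)
open import Data.Nat.Properties using (n≮0; n<1+n; ≤-<-trans; <-irrefl)
open import Data.Bool using (Bool; T)
open import Data.Bool.Properties using (T-≡)
open import Data.Fin using (Fin; _≟_)
open import Data.Fin.Subset
  using (Subset; _∈_; _∉_; ∣_∣; _∪_; _─_; _-_; ⁅_⁆; ∁; ⊤; Empty; inside; outside)
open import Data.Fin.Subset.Properties
open import Data.Vec using (tabulate; _∷_)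
open import Data.Vec.Properties using (lookup∘tabulate; lookup⇒[]=; []=⇒lookup)
open import Data.Vec.Base using (there)
open import Data.Product using (_×_; _,_; ∃; ∃₂)
open import Data.Sum using (_⊎_; inj₁; inj₂)
open import Function.Bundles using (Equivalence)
open import Relation.Nullary using (¬_; yes; no)
open import Relation.Nullary.Negation using (contradiction)
open import Relation.Binary.PropositionalEquality using (_≡_; _≢_; refl; sym; trans; subst)

private
  variable
    m : ℕ
    x : Fin m
    p q : Subset m

x∈p─q⇒x∉q : x ∈ p ─ q → x ∉ q
x∈p─q⇒x∉q {p = _ ∷ p} {q = outside ∷ q} (there x∈) (there x∈q) = x∈p─q⇒x∉q {p = p} x∈ x∈q
x∈p─q⇒x∉q {p = _ ∷ p} {q = inside ∷ q}  (there x∈) (there x∈q) = x∈p─q⇒x∉q {p = p} x∈ x∈q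

x∉p-x : x ∉ p - x
x∉p-x {x = x} x∈ = x∈p─q⇒x∉q x∈ (x∈⁅x⁆ x)

x∈p⇒∣p∣≢0 : x ∈ p → ∣ p ∣ ≢ 0
x∈p⇒∣p∣≢0 {x = x} {p = p} x∈p ∣p∣≡0 = n≮0 (subst (∣ p - x ∣ <_) ∣p∣≡0 (x∈p⇒∣p-x∣<∣p∣ x∈p))

Empty⇒∣p∣≡0 : Empty p → ∣ p ∣ ≡ 0
Empty⇒∣p∣≡0 {m} p-empty rewrite Empty-unique p-empty = ∣⊥∣≡0 m

∈-tabulate⁺ : (f : Fin m → Bool) → T (f x) → x ∈ tabulate f
∈-tabulate⁺ {x = x} f fx =
  lookup⇒[]= x (tabulate f) (trans (lookup∘tabulate f x) (Equivalence.to T-≡ fx))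

∈-tabulate⁻ : (f : Fin m → Bool) → x ∈ tabulate f → T (f x)
∈-tabulate⁻ {x = x} f x∈ =
  Equivalence.from T-≡ (trans (sym (lookup∘tabulate f x)) ([]=⇒lookup x∈))

∣∁⁅x⁆∣<n : (x : Fin m) → ∣ ∁ ⁅ x ⁆ ∣ < m
∣∁⁅x⁆∣<n {suc m} x rewrite ∣∁p∣≡n∸∣p∣ ⁅ x ⁆ | ∣⁅x⁆∣≡1 x = n<1+n m

module _ {n : ℕ} (D : Digraph n) where

  Transit : Fin n → Set
  Transit u = ∃₂ λ a b → Arc D a u × Arc D u b

  Arc⇒≢ : ∀ {u v} → Arc D u v → u ≢ v
  Arc⇒≢ {u} uu refl = subst T (loopless D u) uu

  sourceOrSink⇒¬Transit : ∀ {u} → d⁺ D u ≡ 0 ⊎ d⁻ D u ≡ 0 → ¬ Transit u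
  sourceOrSink⇒¬Transit {u} (inj₁ d⁺≡0) (_ , b , _ , ub) =
    x∈p⇒∣p∣≢0 (∈-tabulate⁺ (arc D u) ub) d⁺≡0
  sourceOrSink⇒¬Transit {u} (inj₂ d⁻≡0) (a , _ , au , _) =
    x∈p⇒∣p∣≢0 (∈-tabulate⁺ (λ w → arc D w u) au) d⁻≡0

  ¬Transit⇒sourceOrSink : ∀ {u} → ¬ Transit u → d⁺ D u ≡ 0 ⊎ d⁻ D u ≡ 0
  ¬Transit⇒sourceOrSink {u} ¬transit with nonempty? (N⁺ D u) | nonempty? (N⁻ D u)
  ... | no out-empty | _           = inj₁ (Empty⇒∣p∣≡0 out-empty)
  ... | yes _        | no in-empty = inj₂ (Empty⇒∣p∣≡0 in-empty)
  ... | yes (b , b∈) | yes (a , a∈) =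
    contradiction (a , b , ∈-tabulate⁻ (λ w → arc D w u) a∈ , ∈-tabulate⁻ (arc D u) b∈) ¬transit

  noTransit⇒SODS-full : (∀ u → ¬ Transit u) → ∀ {S} → SODS D S → ∀ v → v ∈ S
  noTransit⇒SODS-full noTransit {S} (dom , secure) v with v ∈? S
  ... | yes v∈S = v∈S
  ... | no v∉S with dom v v∉S | secure v v∉S
  ... | u , _ , uv | w , _ , inj₁ vw , _ = contradiction (u , w , uv , vw) (noTransit v)
  ... | _ | w , w∈S , inj₂ wv , swapped-dom with swapped-dom w w∉swapped
    where
    w∉swapped : w ∉ (S - w) ∪ ⁅ v ⁆
    w∉swapped w∈ with x∈p∪q⁻ (S - w) ⁅ v ⁆ w∈
    ... | inj₁ w∈S-w = x∉p-x w∈S-w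
    ... | inj₂ w∈⁅v⁆ = v∉S (subst (_∈ S) (x∈⁅y⁆⇒x≡y v w∈⁅v⁆) w∈S)
  ... | x , _ , xw = contradiction (x , v , xw , wv) (noTransit w)

  ⊤-SODS : SODS D ⊤
  ⊤-SODS = (λ _ v∉⊤ → contradiction ∈⊤ v∉⊤) , (λ _ v∉⊤ → contradiction ∈⊤ v∉⊤)

  noTransit⇒γso≡n : (∀ u → ¬ Transit u) → γso≡ D n
  noTransit⇒γso≡n noTransit =
    (⊤ , ⊤-SODS , ∣⊤∣≡n n) ,
    λ S sods → subst (_≤ ∣ S ∣) (∣⊤∣≡n n)
                 (p⊆q⇒∣p∣≤∣q∣ {p = ⊤} (λ {v} _ → noTransit⇒SODS-full noTransit sods v))

  ∁⁅transit⁆-SODS : ∀ {a u b} → Arc D a u → Arc D u b → SODS D (∁ ⁅ u ⁆)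
  ∁⁅transit⁆-SODS {a} {u} {b} au ub = dom , λ v v∉ → secure v (x∈⁅y⁆⇒x≡y u (x∉∁p⇒x∈p v∉))
    where
    ∈∁⁅u⁆ : ∀ {v} → v ≢ u → v ∈ ∁ ⁅ u ⁆
    ∈∁⁅u⁆ v≢u = x∉p⇒x∈∁p (x≢y⇒x∉⁅y⁆ v≢u)

    dom : OutDominating D (∁ ⁅ u ⁆)
    dom v v∉ with x∈⁅y⁆⇒x≡y u (x∉∁p⇒x∈p v∉)
    ... | refl = a , ∈∁⁅u⁆ (Arc⇒≢ au) , au

    swapped-dom : OutDominating D ((∁ ⁅ u ⁆ - b) ∪ ⁅ u ⁆)
    swapped-dom v v∉ with v ≟ b | v ≟ u
    ... | yes refl | _        = u , x∈p∪q⁺ (inj₂ (x∈⁅x⁆ u)) , ub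
    ... | no _     | yes refl = contradiction (x∈p∪q⁺ (inj₂ (x∈⁅x⁆ u))) v∉
    ... | no v≢b   | no v≢u   = contradiction (x∈p∪q⁺ (inj₁ (x∈p∧x≢y⇒x∈p-y (∈∁⁅u⁆ v≢u) v≢b))) v∉

    secure : ∀ v → v ≡ u → ∃ λ w → w ∈ ∁ ⁅ u ⁆ × (Arc D v w ⊎ Arc D w v)
                                  × OutDominating D ((∁ ⁅ u ⁆ - w) ∪ ⁅ v ⁆)
    secure v refl = b , ∈∁⁅u⁆ (λ b≡u → Arc⇒≢ ub (sym b≡u)) , inj₁ ub , swapped-dom

  γso≡n⇒¬Transit : γso≡ D n → ∀ u → ¬ Transit u
  γso≡n⇒¬Transit (_ , minimal) u (_ , _ , au , ub) =
    <-irrefl refl (≤-<-trans (minimal (∁ ⁅ u ⁆) (∁⁅transit⁆-SODS au ub)) (∣∁⁅x⁆∣<n u))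

theorem4p5 : (n : ℕ) (D : Digraph n) →
    (γso≡ D n → (∀ u → d⁺ D u ≡ 0 ⊎ d⁻ D u ≡ 0)) ×
    ((∀ u → d⁺ D u ≡ 0 ⊎ d⁻ D u ≡ 0) → γso≡ D n)
theorem4p5 n D =
  (λ γso≡n u → ¬Transit⇒sourceOrSink D (γso≡n⇒¬Transit D γso≡n u)) ,
  (λ sourceOrSink → noTransit⇒γso≡n D (λ u → sourceOrSink⇒¬Transit D (sourceOrSink u)))
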